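{- Every geodetic locally connected graph is a complete graph.
   Context: A geodesic is a shortest path; a graph is geodetic if between any two vertices there is exactly one geodesic. A graph is locally connected if for every vertex the subgraph induced by its open neighbourhood (the vertices adjacent to it) is connected. -}

module Defs where

open import Data.Nat using (ℕ; zero; suc; _≤_)
open import Data.Fin using (Fin)
open import Data.Bool using (Bool; true; false; T)
open import Data.Product using (Σ; _×_; ∃)
open import Relation.Binary.PropositionalEquality using (_≡_; _≢_)

record Graph (n : ℕ) : Set where
  field
    adj    : Fin n → Fin n → Bool
    sym    : ∀ u v → adj u v ≡ adj v u
    irrefl : ∀ u → adj u u ≡ false

module _ {n : ℕ} (G : Graph n) where
  open Graph G

  Adj : Fin n → Fin n → Set
  Adj u v = T (adj u v)

  data Walk : Fin n → Fin n → Set where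
    []  : ∀ {u} → Walk u u
    _∷_ : ∀ {u w v} → Adj u w → Walk w v → Walk u v

  length : ∀ {u v} → Walk u v → ℕ
  length []      = zero
  length (_ ∷ p) = suc (length p)

  -- A geodesic is a shortest u–v path (a walk of minimum length;
  -- such a walk is automatically a path).
  IsGeodesic : ∀ {u v} → Walk u v → Set
  IsGeodesic {u} {v} p = ∀ (q : Walk u v) → length p ≤ length q

  Geodetic : Set
  Geodetic = ∀ u v →
    Σ (Walk u v) IsGeodesic
    × (∀ (p q : Walk u v) → IsGeodesic p → IsGeodesic q → p ≡ q)

  data WalkWithin (S : Fin n → Set) : ∀ {u v} → Walk u v → Set where
    []  : ∀ {u} → S u → WalkWithin S ([] {u})
    _∷_ : ∀ {u w v} {e : Adj u w} {p : Walk w v} →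
          S u → WalkWithin S p → WalkWithin S (e ∷ p)

  InducedConnected : (Fin n → Set) → Set
  InducedConnected S = ∀ x y → S x → S y → ∃ λ (p : Walk x y) → WalkWithin S p

  N : Fin n → Fin n → Set
  N v x = Adj v x

  LocallyConnected : Set
  LocallyConnected = ∀ v → InducedConnected (N v)

  Complete : Set
  Complete = ∀ u v → u ≢ v → Adj u v

{-# OPTIONS --safe #-}
-- Suppose u ≠ v are non-adjacent and u – x – w – … – v is the geodesic between
-- them. Then w is at distance 2 from u, and both lie in the neighbourhood N(x),
-- so a path inside N(x) leads from u to w. Somewhere it has to step from a vertex
-- y of the closed neighbourhood N[u] to a vertex z outside it. Then y ≠ u, and
-- u – y – z and u – x – z are two geodesics of length 2, so y = x by geodeticity;
-- but y ∈ N(x), contradicting irreflexivity.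
module Submission where

open import Defs
open import Data.Nat using (ℕ; s≤s; z≤n)
open import Data.Nat.Properties using (≤-trans; n≤1+n; 1+n≰n)
open import Data.Fin using (Fin; _≟_)
open import Data.Bool using (T)
open import Data.Product using (∃₂; _×_; _,_; proj₁; proj₂)
open import Data.Sum using (_⊎_; inj₁; inj₂)
open import Data.Empty using (⊥-elim)
open import Relation.Nullary using (¬_; yes; no)
open import Relation.Nullary.Decidable.Core using (T?; _⊎-dec_)
open import Relation.Unary using (Decidable)
open import Relation.Binary.PropositionalEquality using (_≡_; refl; cong; subst)

module _ {n : ℕ} (G : Graph n) where

  Adj-sym : ∀ {u v} → Adj G u v → Adj G v u
  Adj-sym {u} {v} = subst T (Graph.sym G u v)

  Adj-irrefl : ∀ {u} → ¬ Adj G u u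
  Adj-irrefl {u} = subst T (Graph.irrefl G u)

  ClosedN : Fin n → Fin n → Set
  ClosedN a y = y ≡ a ⊎ Adj G a y

  closedN? : ∀ a → Decidable (ClosedN a)
  closedN? a y = (y ≟ a) ⊎-dec T? (Graph.adj G a y)

  secondVertex : ∀ {u v} → Walk G u v → Fin n
  secondVertex {u} []            = u
  secondVertex (_∷_ {w = w} _ _) = w

  walkWithin-head : ∀ {S u v} {p : Walk G u v} → WalkWithin G S p → S u
  walkWithin-head ([] s)  = s
  walkWithin-head (s ∷ _) = s

  length2-isGeodesic : ∀ {a y z} → ¬ ClosedN a z →
    (e₁ : Adj G a y) (e₂ : Adj G y z) → IsGeodesic G (e₁ ∷ (e₂ ∷ []))
  length2-isGeodesic z∉N[a] _ _ []            = ⊥-elim (z∉N[a] (inj₁ refl))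
  length2-isGeodesic z∉N[a] _ _ (e ∷ [])      = ⊥-elim (z∉N[a] (inj₂ e))
  length2-isGeodesic z∉N[a] _ _ (_ ∷ (_ ∷ _)) = s≤s (s≤s z≤n)

  geodetic-commonNeighbour-unique : Geodetic G → ∀ {a y b z} → ¬ ClosedN a z →
    Adj G a y → Adj G y z → Adj G a b → Adj G b z → y ≡ b
  geodetic-commonNeighbour-unique geo {a} {z = z} z∉N[a] ay yz ab bz =
    cong secondVertex
      (proj₂ (geo a z) (ay ∷ (yz ∷ [])) (ab ∷ (bz ∷ []))
        (length2-isGeodesic z∉N[a] ay yz)
        (length2-isGeodesic z∉N[a] ab bz))

  walkWithin-exit : ∀ {S P : Fin n → Set} → Decidable P →
    ∀ {y c} (p : Walk G y c) → WalkWithin G S p → P y → ¬ P c →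
    ∃₂ λ x z → S x × S z × Adj G x z × P x × ¬ P z
  walkWithin-exit P? [] _ py ¬pc = ⊥-elim (¬pc py)
  walkWithin-exit P? (_∷_ {w = z} e p) (sy ∷ w) py ¬pc with P? z
  ... | yes pz = walkWithin-exit P? p w pz ¬pc
  ... | no ¬pz = _ , z , sy , walkWithin-head w , e , py , ¬pz

  geodetic-neighbourhoodWalk-stays : Geodetic G → ∀ {a b c} → Adj G b a →
    (p : Walk G a c) → WalkWithin G (N G b) p → ClosedN a c
  geodetic-neighbourhoodWalk-stays geo {a} {b} {c} ba p w with closedN? a c
  ... | yes c∈N[a] = c∈N[a]
  ... | no c∉N[a] with walkWithin-exit (closedN? a) p w (inj₁ refl) c∉N[a]
  ... | _ , _ , _ , _ , yz , inj₁ refl , z∉N[a] = ⊥-elim (z∉N[a] (inj₂ yz))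
  ... | y , _ , by , bz , yz , inj₂ ay , z∉N[a] =
    ⊥-elim (Adj-irrefl (subst (Adj G b) y≡b by))
    where
      y≡b : y ≡ b
      y≡b = geodetic-commonNeighbour-unique geo z∉N[a] ay yz (Adj-sym ba) bz

  geodesic-thirdVertex-notClosedN : ∀ {u x w v} (e₁ : Adj G u x) (e₂ : Adj G x w)
    (q : Walk G w v) → IsGeodesic G (e₁ ∷ (e₂ ∷ q)) → ¬ ClosedN u w
  geodesic-thirdVertex-notClosedN _ _ q isGeo (inj₁ refl) =
    1+n≰n (≤-trans (isGeo q) (n≤1+n _))
  geodesic-thirdVertex-notClosedN _ _ q isGeo (inj₂ uw) = 1+n≰n (isGeo (uw ∷ q))

proposition4 : ∀ (n : ℕ) (G : Graph n) → Geodetic G → LocallyConnected G → Complete G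
proposition4 n G geo lc u v u≢v with T? (Graph.adj G u v) | proj₁ (geo u v)
... | yes uv | _             = uv
... | no ¬uv | [] , _        = ⊥-elim (u≢v refl)
... | no ¬uv | (uv ∷ []) , _ = ⊥-elim (¬uv uv)
... | no ¬uv | (ux ∷ (xw ∷ q)) , isGeo
  with lc _ u _ (Adj-sym G ux) xw
... | p , within =
  ⊥-elim (geodesic-thirdVertex-notClosedN G ux xw q isGeo
    (geodetic-neighbourhoodWalk-stays G geo (Adj-sym G ux) p within))
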